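{- Let $G$ be an $r$-regular finite simple graph with $n$ vertices and $m$ edges. Then \[NK(G^{+-+}) = 2^{n}r^{n}(m+3-2r)^{m}.\]
   Context: For a graph $H$, $NK(H)=\prod_{v\in V(H)} d_H(v)$ (Narumi-Katayama index). For $x,y,z\in\{+,-\}$ the total transformation graph $G^{xyz}$ has vertex set $V(G)\cup E(G)$ (disjoint union) and two distinct vertices are adjacent as follows: two vertices of $G$ are adjacent iff they are adjacent in $G$ (if $x=+$), resp. non-adjacent in $G$ (if $x=-$); two edges of $G$ are adjacent iff they share an endpoint in $G$ (if $y=+$), resp. share no endpoint (if $y=-$); a vertex $u$ and an edge $e$ of $G$ are adjacent iff $u$ is incident to $e$ (if $z=+$), resp. not incident (if $z=-$). -}

module Defs where

open import Data.Nat using (ℕ; zero; suc)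
open import Data.Fin using (Fin) renaming (_≟_ to _≟ᶠ_)
open import Data.Product using (_×_; _,_; proj₁; proj₂)
open import Data.Sum using (_⊎_; inj₁; inj₂)
open import Data.Sum.Properties using (≡-dec)
open import Data.Bool using (Bool; true; false; not; _∧_; _∨_; if_then_else_)
open import Data.List using (List; []; _∷_; map; _++_; allFin)
open import Data.Nat.ListAction using (product)
open import Data.Bool.ListAction using (any)
open import Relation.Binary.PropositionalEquality using (_≡_; _≢_)
open import Relation.Binary.Definitions using (DecidableEquality)
open import Relation.Nullary.Decidable using (⌊_⌋)

count : {A : Set} → (A → Bool) → List A → ℕ
count p [] = zero
count p (x ∷ xs) = if p x then suc (count p xs) else count p xs

-- Generic finite simple graph given by an enumeration of its vertex set
-- (a duplicate-free list), decidable equality and a Boolean adjacency.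
-- d_H(v) = number of vertices w ≠ v adjacent to v.

degree : {V : Set} → DecidableEquality V → List V → (V → V → Bool) → V → ℕ
degree _≟_ vs adj v = count (λ w → not ⌊ w ≟ v ⌋ ∧ adj v w) vs

NK : {V : Set} → DecidableEquality V → List V → (V → V → Bool) → ℕ
NK _≟_ vs adj = product (map (degree _≟_ vs adj) vs)

sameEnds : {n : ℕ} → Fin n × Fin n → Fin n × Fin n → Set
sameEnds (a , b) (c , d) = (a ≡ c × b ≡ d) ⊎ (a ≡ d × b ≡ c)

record Graph (n m : ℕ) : Set where
  field
    ends     : Fin m → Fin n × Fin n
    loopless : ∀ e → proj₁ (ends e) ≢ proj₂ (ends e)
    noMulti  : ∀ e f → sameEnds (ends e) (ends f) → e ≡ f

module _ {n m : ℕ} (G : Graph n m) where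
  open Graph G

  incident : Fin n → Fin m → Bool
  incident u e = ⌊ u ≟ᶠ proj₁ (ends e) ⌋ ∨ ⌊ u ≟ᶠ proj₂ (ends e) ⌋

  adjG : Fin n → Fin n → Bool
  adjG u v = any (λ e → (⌊ proj₁ (ends e) ≟ᶠ u ⌋ ∧ ⌊ proj₂ (ends e) ≟ᶠ v ⌋)
                      ∨ (⌊ proj₁ (ends e) ≟ᶠ v ⌋ ∧ ⌊ proj₂ (ends e) ≟ᶠ u ⌋))
                 (allFin m)

  shareEnd : Fin m → Fin m → Bool
  shareEnd e f = incident (proj₁ (ends e)) f ∨ incident (proj₂ (ends e)) f

  degG : Fin n → ℕ
  degG = degree _≟ᶠ_ (allFin n) adjG

  Regular : ℕ → Set
  Regular r = ∀ v → degG v ≡ r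

data Sign : Set where
  plus minus : Sign

apply : Sign → Bool → Bool
apply plus  b = b
apply minus b = not b

module _ {n m : ℕ} (G : Graph n m) where

  TV : Set
  TV = Fin n ⊎ Fin m

  _≟T_ : DecidableEquality TV
  _≟T_ = ≡-dec _≟ᶠ_ _≟ᶠ_

  TVs : List TV
  TVs = map inj₁ (allFin n) ++ map inj₂ (allFin m)

  -- adjacency of G^{xyz}; distinctness of the two vertices is imposed
  -- in 'degree'
  totalAdj : Sign → Sign → Sign → TV → TV → Bool
  totalAdj x y z (inj₁ u) (inj₁ v) = apply x (adjG G u v)
  totalAdj x y z (inj₂ e) (inj₂ f) = apply y (shareEnd G e f)
  totalAdj x y z (inj₁ u) (inj₂ e) = apply z (incident G u e)
  totalAdj x y z (inj₂ e) (inj₁ u) = apply z (incident G u e)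

  NKtotal : Sign → Sign → Sign → ℕ
  NKtotal x y z = NK _≟T_ TVs (totalAdj x y z)

module Submission where

-- In G^{+-+} a vertex u is adjacent to its deg u neighbours and to its deg u incident edges, so it
-- has degree 2 deg u.  An edge e = uv is adjacent to its two endpoints and to the edges sharing no
-- endpoint with it; by inclusion-exclusion exactly deg u + deg v - 1 edges share an endpoint with e
-- (only e itself shares both), so e has degree m + 3 - (deg u + deg v).  For an r-regular G the
-- degrees are therefore 2r on the n vertices and m + 3 - 2r on the m edges.

open import Defs
open import Algebra.Properties.CommutativeSemigroup using (interchange)
open import Data.Bool using (Bool; true; false; not; _∧_; _∨_; T)
open import Data.Bool.ListAction using (any)
open import Data.Bool.Properties using (T-≡; T-∧; T-∨)
open import Data.Empty using (⊥; ⊥-elim)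
open import Data.Fin using (Fin; zero; suc)
open import Data.Fin.Properties using (_≟_; suc-injective)
open import Data.List using ([]; _∷_; map; _++_; tabulate; allFin; length)
open import Data.List.Properties using (map-++; map-∘; length-tabulate)
open import Data.Nat using (ℕ; zero; suc; _+_; _*_; _∸_; _^_)
open import Data.Nat.ListAction using (product)
open import Data.Nat.Solver using (module +-*-Solver)
open import Data.Nat.ListAction.Properties using (product-++)
open import Data.Nat.Properties
  using (+-*-semiring; *-commutativeSemigroup; +-identityʳ; *-identityˡ; *-identityʳ; m+n∸n≡m)
open import Algebra.Properties.Semiring.Sum +-*-semiring
  using (sum-syntax; sum-cong-≗; ∑-distrib-+; ∑-comm; sum-replicate-zero; *-distribˡ-sum; *-distribʳ-sum)
open import Data.Product using (_×_; _,_; proj₁; proj₂)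
open import Data.Sum using (inj₁; inj₂)
open import Function using (_∘_; id)
open import Function.Bundles using (Equivalence)
open import Relation.Binary.PropositionalEquality
open import Relation.Nullary using (yes; no; ¬_)
open import Relation.Nullary.Decidable using (⌊_⌋; ⌊⌋-map′; toWitness; fromWitness; fromWitnessFalse)

open Equivalence using (to; from)

⟦_⟧ : Bool → ℕ
⟦ true ⟧  = 1
⟦ false ⟧ = 0

⟦∧⟧ : ∀ x y → ⟦ x ∧ y ⟧ ≡ ⟦ x ⟧ * ⟦ y ⟧
⟦∧⟧ true  y = sym (*-identityˡ ⟦ y ⟧)
⟦∧⟧ false y = refl

⟦∨⟧+⟦∧⟧ : ∀ x y → ⟦ x ∨ y ⟧ + ⟦ x ∧ y ⟧ ≡ ⟦ x ⟧ + ⟦ y ⟧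
⟦∨⟧+⟦∧⟧ true  true  = refl
⟦∨⟧+⟦∧⟧ true  false = refl
⟦∨⟧+⟦∧⟧ false true  = refl
⟦∨⟧+⟦∧⟧ false false = refl

⟦∨⟧-disjoint : ∀ x y → (T x → T y → ⊥) → ⟦ x ∨ y ⟧ ≡ ⟦ x ⟧ + ⟦ y ⟧
⟦∨⟧-disjoint true  true  disjoint = ⊥-elim (disjoint _ _)
⟦∨⟧-disjoint true  false _ = refl
⟦∨⟧-disjoint false true  _ = refl
⟦∨⟧-disjoint false false _ = refl

⟦not⟧+⟦⟧ : ∀ x → ⟦ not x ⟧ + ⟦ x ⟧ ≡ 1
⟦not⟧+⟦⟧ true  = refl
⟦not⟧+⟦⟧ false = refl

∧-redundantˡ : ∀ x y → (T y → T x) → x ∧ y ≡ y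
∧-redundantˡ true  y     _ = refl
∧-redundantˡ false false _ = refl
∧-redundantˡ false true  y⇒x = ⊥-elim (y⇒x _)

T-not⇒¬T : ∀ b → T (not b) → ¬ T b
T-not⇒¬T true  ()
T-not⇒¬T false _ ()

T-injective : ∀ x y → (T x → T y) → (T y → T x) → x ≡ y
T-injective true  true  _ _ = refl
T-injective false false _ _ = refl
T-injective true  false x⇒y _ = ⊥-elim (x⇒y _)
T-injective false true  _ y⇒x = ⊥-elim (y⇒x _)

T-⌊≟⌋ : ∀ {k} {i j : Fin k} → T ⌊ i ≟ j ⌋ → i ≡ j
T-⌊≟⌋ {i = i} {j} = toWitness {a? = i ≟ j}

≡⇒T-⌊≟⌋ : ∀ {k} {i j : Fin k} → i ≡ j → T ⌊ i ≟ j ⌋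
≡⇒T-⌊≟⌋ {i = i} {j} = fromWitness {a? = i ≟ j}

≢⇒T-not-⌊≟⌋ : ∀ {k} {i j : Fin k} → ¬ i ≡ j → T (not ⌊ i ≟ j ⌋)
≢⇒T-not-⌊≟⌋ {i = i} {j} = fromWitnessFalse {a? = i ≟ j}

⌊≟⌋-sym : ∀ {k} (i j : Fin k) → ⌊ i ≟ j ⌋ ≡ ⌊ j ≟ i ⌋
⌊≟⌋-sym i j = T-injective _ _ (≡⇒T-⌊≟⌋ ∘ sym ∘ T-⌊≟⌋) (≡⇒T-⌊≟⌋ ∘ sym ∘ T-⌊≟⌋)

∑-zero : ∀ {k} {f : Fin k → ℕ} → (∀ i → f i ≡ 0) → ∑[ i < k ] f i ≡ 0
∑-zero {k} f≗0 = trans (sum-cong-≗ f≗0) (sum-replicate-zero k)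

∑-≟ : ∀ {k} (a : Fin k) → ∑[ i < k ] ⟦ ⌊ a ≟ i ⌋ ⟧ ≡ 1
∑-≟ {suc k} zero    = cong suc (sum-replicate-zero k)
∑-≟ {suc k} (suc a) =
  trans (sum-cong-≗ λ i → cong ⟦_⟧ (⌊⌋-map′ (cong suc) suc-injective (a ≟ i))) (∑-≟ a)

∑-const-1 : ∀ k → ∑[ i < k ] 1 ≡ k
∑-const-1 zero    = refl
∑-const-1 (suc k) = cong suc (∑-const-1 k)

∑-not+∑ : ∀ {k} (p : Fin k → Bool) → ∑[ i < k ] ⟦ not (p i) ⟧ + ∑[ i < k ] ⟦ p i ⟧ ≡ k
∑-not+∑ {k} p = begin
  ∑[ i < k ] ⟦ not (p i) ⟧ + ∑[ i < k ] ⟦ p i ⟧  ≡⟨ ∑-distrib-+ (⟦_⟧ ∘ not ∘ p) (⟦_⟧ ∘ p) ⟨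
  ∑[ i < k ] (⟦ not (p i) ⟧ + ⟦ p i ⟧)          ≡⟨ sum-cong-≗ (⟦not⟧+⟦⟧ ∘ p) ⟩
  ∑[ i < k ] 1                                  ≡⟨ ∑-const-1 k ⟩
  k                                             ∎
  where open ≡-Reasoning

count-tabulate : ∀ {A : Set} {k} (p : A → Bool) (f : Fin k → A) →
                 count p (tabulate f) ≡ ∑[ i < k ] ⟦ p (f i) ⟧
count-tabulate {k = zero}  p f = refl
count-tabulate {k = suc k} p f with p (f zero)
... | true  = cong suc (count-tabulate p (f ∘ suc))
... | false = count-tabulate p (f ∘ suc)

any-tabulate : ∀ {A : Set} {k} (p : A → Bool) (f : Fin k → A) →
               (∀ i j → T (p (f i)) → T (p (f j)) → i ≡ j) →
               ⟦ any p (tabulate f) ⟧ ≡ ∑[ i < k ] ⟦ p (f i) ⟧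
any-tabulate {k = zero}  p f unique = refl
any-tabulate {k = suc k} p f unique with p (f zero) in p₀
... | true  = cong suc (sym (∑-zero rest-false))
  where
  rest-false : ∀ i → ⟦ p (f (suc i)) ⟧ ≡ 0
  rest-false i with p (f (suc i)) in pᵢ
  ... | false = refl
  ... | true  with () ← unique zero (suc i) (from T-≡ p₀) (from T-≡ pᵢ)
... | false = any-tabulate p (f ∘ suc) λ i j pᵢ pⱼ → suc-injective (unique (suc i) (suc j) pᵢ pⱼ)

count-++ : ∀ {A : Set} (p : A → Bool) xs ys → count p (xs ++ ys) ≡ count p xs + count p ys
count-++ p []       ys = refl
count-++ p (x ∷ xs) ys with p x
... | true  = cong suc (count-++ p xs ys)
... | false = count-++ p xs ys

count-map : ∀ {A B : Set} (p : B → Bool) (f : A → B) xs → count p (map f xs) ≡ count (p ∘ f) xs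
count-map p f []       = refl
count-map p f (x ∷ xs) with p (f x)
... | true  = cong suc (count-map p f xs)
... | false = count-map p f xs

product-map-const : ∀ {A : Set} (f : A → ℕ) {c} → (∀ x → f x ≡ c) →
                    ∀ xs → product (map f xs) ≡ c ^ length xs
product-map-const f f≡c []       = refl
product-map-const f f≡c (x ∷ xs) = cong₂ _*_ (f≡c x) (product-map-const f f≡c xs)

^-distribʳ-* : ∀ a b n → (a * b) ^ n ≡ a ^ n * b ^ n
^-distribʳ-* a b zero    = refl
^-distribʳ-* a b (suc n) =
  trans (cong (a * b *_) (^-distribʳ-* a b n)) (interchange *-commutativeSemigroup a b (a ^ n) (b ^ n))

module _ {n m : ℕ} (G : Graph n m) where
  open Graph G

  end₁ end₂ : Fin m → Fin n
  end₁ e = proj₁ (ends e)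
  end₂ e = proj₂ (ends e)

  -- the summand of adjG, so that adjG G u v is definitionally any (λ e → joins e u v) (allFin m)
  joins : Fin m → Fin n → Fin n → Bool
  joins e u v = (⌊ end₁ e ≟ u ⌋ ∧ ⌊ end₂ e ≟ v ⌋) ∨ (⌊ end₁ e ≟ v ⌋ ∧ ⌊ end₂ e ≟ u ⌋)

  joins⇒sameEnds : ∀ e {u v} → T (joins e u v) → sameEnds (ends e) (u , v)
  joins⇒sameEnds e t with to T-∨ t
  ... | inj₁ t₁ = let p , q = to T-∧ t₁ in inj₁ (T-⌊≟⌋ p , T-⌊≟⌋ q)
  ... | inj₂ t₂ = let p , q = to T-∧ t₂ in inj₂ (T-⌊≟⌋ p , T-⌊≟⌋ q)

  joins-unique : ∀ e f {u v} → T (joins e u v) → T (joins f u v) → e ≡ f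
  joins-unique e f tₑ t_f with joins⇒sameEnds e tₑ | joins⇒sameEnds f t_f
  ... | inj₁ (p , q) | inj₁ (r , s) = noMulti e f (inj₁ (trans p (sym r) , trans q (sym s)))
  ... | inj₁ (p , q) | inj₂ (r , s) = noMulti e f (inj₂ (trans p (sym s) , trans q (sym r)))
  ... | inj₂ (p , q) | inj₁ (r , s) = noMulti e f (inj₂ (trans p (sym s) , trans q (sym r)))
  ... | inj₂ (p , q) | inj₂ (r , s) = noMulti e f (inj₁ (trans p (sym r) , trans q (sym s)))

  joins⇒≢ : ∀ e {u v} → T (joins e u v) → ¬ v ≡ u
  joins⇒≢ e t v≡u with joins⇒sameEnds e t
  ... | inj₁ (p , q) = loopless e (trans p (trans (sym v≡u) (sym q)))
  ... | inj₂ (p , q) = loopless e (trans p (trans v≡u (sym q)))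

  ⟦joins⟧ : ∀ e u v → ⟦ joins e u v ⟧
            ≡ ⟦ ⌊ end₁ e ≟ u ⌋ ⟧ * ⟦ ⌊ end₂ e ≟ v ⌋ ⟧ + ⟦ ⌊ end₁ e ≟ v ⌋ ⟧ * ⟦ ⌊ end₂ e ≟ u ⌋ ⟧
  ⟦joins⟧ e u v = trans (⟦∨⟧-disjoint (⌊ end₁ e ≟ u ⌋ ∧ ⌊ end₂ e ≟ v ⌋) _ disjoint)
                        (cong₂ _+_ (⟦∧⟧ ⌊ end₁ e ≟ u ⌋ _) (⟦∧⟧ ⌊ end₁ e ≟ v ⌋ _))
    where
    disjoint : T (⌊ end₁ e ≟ u ⌋ ∧ ⌊ end₂ e ≟ v ⌋) → T (⌊ end₁ e ≟ v ⌋ ∧ ⌊ end₂ e ≟ u ⌋) → ⊥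
    disjoint t₁ t₂ = loopless e (trans (T-⌊≟⌋ (proj₁ (to T-∧ t₂))) (sym (T-⌊≟⌋ (proj₂ (to T-∧ t₁)))))

  ⟦incident⟧ : ∀ u e → ⟦ incident G u e ⟧ ≡ ⟦ ⌊ end₁ e ≟ u ⌋ ⟧ + ⟦ ⌊ end₂ e ≟ u ⌋ ⟧
  ⟦incident⟧ u e = begin
    ⟦ ⌊ u ≟ end₁ e ⌋ ∨ ⌊ u ≟ end₂ e ⌋ ⟧
      ≡⟨ ⟦∨⟧-disjoint ⌊ u ≟ end₁ e ⌋ _ (λ p q → loopless e (trans (sym (T-⌊≟⌋ p)) (T-⌊≟⌋ q))) ⟩
    ⟦ ⌊ u ≟ end₁ e ⌋ ⟧ + ⟦ ⌊ u ≟ end₂ e ⌋ ⟧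
      ≡⟨ cong₂ (λ a b → ⟦ a ⟧ + ⟦ b ⟧) (⌊≟⌋-sym u (end₁ e)) (⌊≟⌋-sym u (end₂ e)) ⟩
    ⟦ ⌊ end₁ e ≟ u ⌋ ⟧ + ⟦ ⌊ end₂ e ≟ u ⌋ ⟧ ∎
    where open ≡-Reasoning

  ∑-incident : ∀ e → ∑[ u < n ] ⟦ incident G u e ⟧ ≡ 2
  ∑-incident e = begin
    ∑[ u < n ] ⟦ incident G u e ⟧
      ≡⟨ sum-cong-≗ (λ u → ⟦incident⟧ u e) ⟩
    ∑[ u < n ] (⟦ ⌊ end₁ e ≟ u ⌋ ⟧ + ⟦ ⌊ end₂ e ≟ u ⌋ ⟧)
      ≡⟨ ∑-distrib-+ (λ u → ⟦ ⌊ end₁ e ≟ u ⌋ ⟧) (λ u → ⟦ ⌊ end₂ e ≟ u ⌋ ⟧) ⟩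
    ∑[ u < n ] ⟦ ⌊ end₁ e ≟ u ⌋ ⟧ + ∑[ u < n ] ⟦ ⌊ end₂ e ≟ u ⌋ ⟧
      ≡⟨ cong₂ _+_ (∑-≟ (end₁ e)) (∑-≟ (end₂ e)) ⟩
    2 ∎
    where open ≡-Reasoning

  ∑-joins : ∀ u e → ∑[ v < n ] ⟦ not ⌊ v ≟ u ⌋ ∧ joins e u v ⟧ ≡ ⟦ incident G u e ⟧
  ∑-joins u e = begin
    ∑[ v < n ] ⟦ not ⌊ v ≟ u ⌋ ∧ joins e u v ⟧
      ≡⟨ sum-cong-≗ (λ v → cong ⟦_⟧ (∧-redundantˡ (not ⌊ v ≟ u ⌋) (joins e u v)
                                                  (≢⇒T-not-⌊≟⌋ ∘ joins⇒≢ e))) ⟩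
    ∑[ v < n ] ⟦ joins e u v ⟧
      ≡⟨ sum-cong-≗ (⟦joins⟧ e u) ⟩
    ∑[ v < n ] (a * ⟦ ⌊ end₂ e ≟ v ⌋ ⟧ + ⟦ ⌊ end₁ e ≟ v ⌋ ⟧ * b)
      ≡⟨ ∑-distrib-+ (λ v → a * ⟦ ⌊ end₂ e ≟ v ⌋ ⟧) (λ v → ⟦ ⌊ end₁ e ≟ v ⌋ ⟧ * b) ⟩
    ∑[ v < n ] (a * ⟦ ⌊ end₂ e ≟ v ⌋ ⟧) + ∑[ v < n ] (⟦ ⌊ end₁ e ≟ v ⌋ ⟧ * b)
      ≡⟨ cong₂ _+_ (*-distribˡ-sum a (λ v → ⟦ ⌊ end₂ e ≟ v ⌋ ⟧))
                   (*-distribʳ-sum b (λ v → ⟦ ⌊ end₁ e ≟ v ⌋ ⟧)) ⟨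
    a * ∑[ v < n ] ⟦ ⌊ end₂ e ≟ v ⌋ ⟧ + ∑[ v < n ] ⟦ ⌊ end₁ e ≟ v ⌋ ⟧ * b
      ≡⟨ cong₂ _+_ (cong (a *_) (∑-≟ (end₂ e))) (cong (_* b) (∑-≟ (end₁ e))) ⟩
    a * 1 + 1 * b
      ≡⟨ cong₂ _+_ (*-identityʳ a) (*-identityˡ b) ⟩
    a + b
      ≡⟨ ⟦incident⟧ u e ⟨
    ⟦ incident G u e ⟧ ∎
    where
    open ≡-Reasoning
    a = ⟦ ⌊ end₁ e ≟ u ⌋ ⟧
    b = ⟦ ⌊ end₂ e ≟ u ⌋ ⟧

  ⟦≢∧adjG⟧ : ∀ u v → ⟦ not ⌊ v ≟ u ⌋ ∧ adjG G u v ⟧ ≡ ∑[ e < m ] ⟦ not ⌊ v ≟ u ⌋ ∧ joins e u v ⟧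
  ⟦≢∧adjG⟧ u v with v ≟ u
  ... | yes _ = sym (sum-replicate-zero m)
  ... | no _  = any-tabulate (λ e → joins e u v) id (λ e f → joins-unique e f)

  degG≡∑incident : ∀ u → degG G u ≡ ∑[ e < m ] ⟦ incident G u e ⟧
  degG≡∑incident u = begin
    degG G u
      ≡⟨ count-tabulate (λ v → not ⌊ v ≟ u ⌋ ∧ adjG G u v) id ⟩
    ∑[ v < n ] ⟦ not ⌊ v ≟ u ⌋ ∧ adjG G u v ⟧
      ≡⟨ sum-cong-≗ (⟦≢∧adjG⟧ u) ⟩
    ∑[ v < n ] ∑[ e < m ] ⟦ not ⌊ v ≟ u ⌋ ∧ joins e u v ⟧
      ≡⟨ ∑-comm (λ v e → ⟦ not ⌊ v ≟ u ⌋ ∧ joins e u v ⟧) ⟩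
    ∑[ e < m ] ∑[ v < n ] ⟦ not ⌊ v ≟ u ⌋ ∧ joins e u v ⟧
      ≡⟨ sum-cong-≗ (∑-joins u) ⟩
    ∑[ e < m ] ⟦ incident G u e ⟧ ∎
    where open ≡-Reasoning

  incident-end₁ : ∀ e → T (incident G (end₁ e) e)
  incident-end₁ e = from (T-∨ {⌊ end₁ e ≟ end₁ e ⌋}) (inj₁ (≡⇒T-⌊≟⌋ refl))

  incident-end₂ : ∀ e → T (incident G (end₂ e) e)
  incident-end₂ e = from (T-∨ {⌊ end₂ e ≟ end₁ e ⌋}) (inj₂ (≡⇒T-⌊≟⌋ refl))

  incident-both-ends : ∀ e f → (incident G (end₁ e) f ∧ incident G (end₂ e) f) ≡ ⌊ e ≟ f ⌋
  incident-both-ends e f = T-injective _ _ (≡⇒T-⌊≟⌋ ∘ both⇒≡ ∘ to T-∧) λ t →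
    from T-∧ (subst (λ g → T (incident G (end₁ e) g)) (T-⌊≟⌋ t) (incident-end₁ e) ,
              subst (λ g → T (incident G (end₂ e) g)) (T-⌊≟⌋ t) (incident-end₂ e))
    where
    both⇒≡ : T (incident G (end₁ e) f) × T (incident G (end₂ e) f) → e ≡ f
    both⇒≡ (t₁ , t₂) with to T-∨ t₁ | to T-∨ t₂
    ... | inj₁ p | inj₁ q = ⊥-elim (loopless e (trans (T-⌊≟⌋ p) (sym (T-⌊≟⌋ q))))
    ... | inj₁ p | inj₂ q = noMulti e f (inj₁ (T-⌊≟⌋ p , T-⌊≟⌋ q))
    ... | inj₂ p | inj₁ q = noMulti e f (inj₂ (T-⌊≟⌋ p , T-⌊≟⌋ q))
    ... | inj₂ p | inj₂ q = ⊥-elim (loopless e (trans (T-⌊≟⌋ p) (sym (T-⌊≟⌋ q))))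

  ∑-shareEnd : ∀ e → ∑[ f < m ] ⟦ shareEnd G e f ⟧ + 1 ≡ degG G (end₁ e) + degG G (end₂ e)
  ∑-shareEnd e = begin
    ∑[ f < m ] ⟦ share f ⟧ + 1
      ≡⟨ cong (∑[ f < m ] ⟦ share f ⟧ +_) (trans (sum-cong-≗ (cong ⟦_⟧ ∘ incident-both-ends e)) (∑-≟ e)) ⟨
    ∑[ f < m ] ⟦ share f ⟧ + ∑[ f < m ] ⟦ inc₁ f ∧ inc₂ f ⟧
      ≡⟨ ∑-distrib-+ (⟦_⟧ ∘ share) (λ f → ⟦ inc₁ f ∧ inc₂ f ⟧) ⟨
    ∑[ f < m ] (⟦ share f ⟧ + ⟦ inc₁ f ∧ inc₂ f ⟧)
      ≡⟨ sum-cong-≗ (λ f → ⟦∨⟧+⟦∧⟧ (inc₁ f) (inc₂ f)) ⟩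
    ∑[ f < m ] (⟦ inc₁ f ⟧ + ⟦ inc₂ f ⟧)
      ≡⟨ ∑-distrib-+ (⟦_⟧ ∘ inc₁) (⟦_⟧ ∘ inc₂) ⟩
    ∑[ f < m ] ⟦ inc₁ f ⟧ + ∑[ f < m ] ⟦ inc₂ f ⟧
      ≡⟨ cong₂ _+_ (degG≡∑incident (end₁ e)) (degG≡∑incident (end₂ e)) ⟨
    degG G (end₁ e) + degG G (end₂ e) ∎
    where
    open ≡-Reasoning
    share inc₁ inc₂ : Fin m → Bool
    share = shareEnd G e
    inc₁  = incident G (end₁ e)
    inc₂  = incident G (end₂ e)

  shareEnd-refl : ∀ e → T (shareEnd G e e)
  shareEnd-refl e = from (T-∨ {incident G (end₁ e) e}) (inj₁ (incident-end₁ e))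

module _ {n m : ℕ} (G : Graph n m) (x y z : Sign) where

  degTotal : TV G → ℕ
  degTotal = degree (_≟T_ G) (TVs G) (totalAdj G x y z)

  NKtotal≡∏vertices*∏edges :
    NKtotal G x y z ≡ product (map (degTotal ∘ inj₁) (allFin n)) * product (map (degTotal ∘ inj₂) (allFin m))
  NKtotal≡∏vertices*∏edges = begin
    product (map degTotal (map inj₁ (allFin n) ++ map inj₂ (allFin m)))
      ≡⟨ cong product (map-++ degTotal (map inj₁ (allFin n)) (map inj₂ (allFin m))) ⟩
    product (map degTotal (map inj₁ (allFin n)) ++ map degTotal (map inj₂ (allFin m)))
      ≡⟨ product-++ (map degTotal (map inj₁ (allFin n))) _ ⟩
    product (map degTotal (map inj₁ (allFin n))) * product (map degTotal (map inj₂ (allFin m)))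
      ≡⟨ cong₂ _*_ (cong product (map-∘ (allFin n))) (cong product (map-∘ (allFin m))) ⟨
    product (map (degTotal ∘ inj₁) (allFin n)) * product (map (degTotal ∘ inj₂) (allFin m)) ∎
    where open ≡-Reasoning

  degTotal≡∑+∑ : ∀ w → degTotal w
    ≡ ∑[ u < n ] ⟦ not ⌊ _≟T_ G (inj₁ u) w ⌋ ∧ totalAdj G x y z w (inj₁ u) ⟧
    + ∑[ f < m ] ⟦ not ⌊ _≟T_ G (inj₂ f) w ⌋ ∧ totalAdj G x y z w (inj₂ f) ⟧
  degTotal≡∑+∑ w = trans (count-++ p (map inj₁ (allFin n)) (map inj₂ (allFin m)))
    (cong₂ _+_ (trans (count-map p inj₁ (allFin n)) (count-tabulate (p ∘ inj₁) id))
               (trans (count-map p inj₂ (allFin m)) (count-tabulate (p ∘ inj₂) id)))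
    where
    p : TV G → Bool
    p w′ = not ⌊ _≟T_ G w′ w ⌋ ∧ totalAdj G x y z w w′

module _ {n m : ℕ} (G : Graph n m) where

  degTotal-vertex : ∀ u → degTotal G plus minus plus (inj₁ u) ≡ 2 * degG G u
  degTotal-vertex u = begin
    degTotal G plus minus plus (inj₁ u)
      ≡⟨ degTotal≡∑+∑ G plus minus plus (inj₁ u) ⟩
    ∑[ v < n ] ⟦ not ⌊ _≟T_ G (inj₁ v) (inj₁ u) ⌋ ∧ adjG G u v ⟧ + ∑[ e < m ] ⟦ incident G u e ⟧
      ≡⟨ cong₂ _+_ (sum-cong-≗ λ v → cong (λ b → ⟦ not b ∧ adjG G u v ⟧) (⌊⌋-map′ (cong inj₁) _ (v ≟ u)))
                   (sym (degG≡∑incident G u)) ⟩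
    ∑[ v < n ] ⟦ not ⌊ v ≟ u ⌋ ∧ adjG G u v ⟧ + degG G u
      ≡⟨ cong (_+ degG G u) (count-tabulate (λ v → not ⌊ v ≟ u ⌋ ∧ adjG G u v) id) ⟨
    degG G u + degG G u
      ≡⟨ cong (degG G u +_) (+-identityʳ (degG G u)) ⟨
    2 * degG G u ∎
    where open ≡-Reasoning

  degTotal-edge : ∀ e → degTotal G plus minus plus (inj₂ e) + (degG G (end₁ G e) + degG G (end₂ G e)) ≡ m + 3
  degTotal-edge e = begin
    degTotal G plus minus plus (inj₂ e) + (degG G (end₁ G e) + degG G (end₂ G e))
      ≡⟨ cong₂ _+_ (sym (degTotal≡∑+∑ G plus minus plus (inj₂ e))) (∑-shareEnd G e) ⟨
    ∑[ u < n ] ⟦ incident G u e ⟧ + ∑[ f < m ] ⟦ not ⌊ _≟T_ G (inj₂ f) (inj₂ e) ⌋ ∧ not (shareEnd G e f) ⟧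
      + (S + 1)
      ≡⟨ cong₂ (λ a b → a + b + (S + 1)) (∑-incident G e) (sum-cong-≗ (cong ⟦_⟧ ∘ ≢-redundant)) ⟩
    2 + N + (S + 1)
      ≡⟨ solve 2 (λ N S → con 2 :+ N :+ (S :+ con 1) := N :+ S :+ con 3) refl N S ⟩
    N + S + 3
      ≡⟨ cong (_+ 3) (∑-not+∑ (shareEnd G e)) ⟩
    m + 3 ∎
    where
    open ≡-Reasoning
    open +-*-Solver using (solve; _:+_; _:=_; con)
    N S : ℕ
    N = ∑[ f < m ] ⟦ not (shareEnd G e f) ⟧
    S = ∑[ f < m ] ⟦ shareEnd G e f ⟧
    ≢-redundant : ∀ f → (not ⌊ _≟T_ G (inj₂ f) (inj₂ e) ⌋ ∧ not (shareEnd G e f)) ≡ not (shareEnd G e f)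
    ≢-redundant f = trans (cong (λ b → not b ∧ not (shareEnd G e f)) (⌊⌋-map′ (cong inj₂) _ (f ≟ e)))
      (∧-redundantˡ (not ⌊ f ≟ e ⌋) _ λ ¬share →
        ≢⇒T-not-⌊≟⌋ λ { refl → T-not⇒¬T _ ¬share (shareEnd-refl G e) })

  module _ {r : ℕ} (regular : Regular G r) where

    degTotal-vertex-regular : ∀ u → degTotal G plus minus plus (inj₁ u) ≡ 2 * r
    degTotal-vertex-regular u = trans (degTotal-vertex u) (cong (2 *_) (regular u))

    degTotal-edge-regular : ∀ e → degTotal G plus minus plus (inj₂ e) ≡ m + 3 ∸ 2 * r
    degTotal-edge-regular e = begin
      d                                            ≡⟨ m+n∸n≡m d (2 * r) ⟨
      d + 2 * r ∸ 2 * r                            ≡⟨ cong (λ k → d + k ∸ 2 * r) ends-degree ⟩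
      d + (degG G (end₁ G e) + degG G (end₂ G e)) ∸ 2 * r  ≡⟨ cong (_∸ 2 * r) (degTotal-edge e) ⟩
      m + 3 ∸ 2 * r                                ∎
      where
      open ≡-Reasoning
      d = degTotal G plus minus plus (inj₂ e)
      ends-degree : 2 * r ≡ degG G (end₁ G e) + degG G (end₂ G e)
      ends-degree = trans (cong (r +_) (+-identityʳ r)) (sym (cong₂ _+_ (regular _) (regular _)))

corollary6 : (n m r : ℕ) (G : Graph n m) → Regular G r →
    NKtotal G plus minus plus ≡ 2 ^ n * r ^ n * (m + 3 ∸ 2 * r) ^ m
corollary6 n m r G regular = begin
  NKtotal G plus minus plus
    ≡⟨ NKtotal≡∏vertices*∏edges G plus minus plus ⟩
  product (map (deg ∘ inj₁) (allFin n)) * product (map (deg ∘ inj₂) (allFin m))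
    ≡⟨ cong₂ _*_ (product-map-const _ (degTotal-vertex-regular G regular) (allFin n))
                 (product-map-const _ (degTotal-edge-regular G regular) (allFin m)) ⟩
  (2 * r) ^ length (allFin n) * (m + 3 ∸ 2 * r) ^ length (allFin m)
    ≡⟨ cong₂ (λ a b → (2 * r) ^ a * (m + 3 ∸ 2 * r) ^ b)
             (length-tabulate {n = n} id) (length-tabulate {n = m} id) ⟩
  (2 * r) ^ n * (m + 3 ∸ 2 * r) ^ m
    ≡⟨ cong (_* (m + 3 ∸ 2 * r) ^ m) (^-distribʳ-* 2 r n) ⟩
  2 ^ n * r ^ n * (m + 3 ∸ 2 * r) ^ m ∎
  where
  open ≡-Reasoning
  deg : TV G → ℕ
  deg = degTotal G plus minus plus
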